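{- Let $C$ be an ACA with input alphabet $\Sigma$ whose time complexity is bounded by $t\colon \mathbb{N}_+ \to \mathbb{N}_0$ (i.e., $C$ accepts every accepted input of length $n$ in at most $t(n)$ steps). Then for any two inputs $w, w'\in\Sigma^+$ with $p_{2\mu}(w) = p_{2\mu}(w')$, $I_{2\mu+1}(w) = I_{2\mu+1}(w')$, and $s_{2\mu}(w) = s_{2\mu}(w')$, where $\mu = \max\{t(|w|), t(|w'|)\}$, we have $w \in L(C)$ if and only if $w' \in L(C)$.
   Context: A cellular automaton (CA) is $C=(Q,\delta,\Sigma)$ with finite state set $Q$, local rule $\delta\colon Q^3\to Q$, input alphabet $\Sigma\subseteq Q$, and an inactive state $q\in Q\setminus\Sigma$ with $\delta(z_1,z_2,z_3)=q$ iff $z_2=q$; the global map is $\Delta(c)(z)=\delta(c(z-1),c(z),c(z+1))$ on $Q^{\mathbb{Z}}$. For input $w\in\Sigma^+$ the initial configuration has $c_0(i)=w(i)$ for $0\le i<|w|$ and $q$ elsewhere. An ACA additionally has a nonempty set $A\subseteq Q\setminus\{q\}$ of accept states; it accepts $w$ if some $\Delta^\tau(c_0)$ has all cells in $A\cup\{q\}$, and the least such $\tau$ is the number of steps in which it accepts $w$; $L(C)$ is the set of accepted words. For a word $w$ and $k\in\mathbb{N}_0$, $p_k(w)$, $s_k(w)$, $I_k(w)$ denote the prefix of length $k$, the suffix of length $k$, and the set of infixes of length $k$ of $w$, with $p_k(w)=s_k(w)=w$ and $I_k(w)=\{w\}$ whenever $k\ge|w|$. -}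

module Defs where

open import Data.Nat using (ℕ; zero; suc; _≤_; _<_; _∸_; _⊔_)
open import Data.Integer using (ℤ; +_; -[1+_]; _+_; _-_; 1ℤ)
open import Data.Fin using (Fin)
open import Data.Bool using (Bool; true; false; T)
open import Data.List using (List; []; _∷_; length; take; drop; _++_)
open import Data.List.Relation.Unary.All using (All)
open import Data.Product using (Σ; ∃; ∃-syntax; _×_; _,_)
open import Data.Sum using (_⊎_)
open import Relation.Binary.PropositionalEquality using (_≡_; _≢_)
open import Relation.Nullary using (¬_)
open import Function using (_⇔_)

-- An ACA: finite state set Q = Fin nQ, local rule δ, input alphabet Σ ⊆ Q
-- (given as a Boolean predicate), inactive state q ∉ Σ, accept states A.
record ACA : Set where
  field
    nQ     : ℕ
    δ      : Fin nQ → Fin nQ → Fin nQ → Fin nQ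
    inΣ    : Fin nQ → Bool
    q      : Fin nQ
    q∉Σ    : inΣ q ≡ false
    δ-q    : ∀ z₁ z₂ z₃ → (δ z₁ z₂ z₃ ≡ q) ⇔ (z₂ ≡ q)
    inA    : Fin nQ → Bool
    A-ne   : ∃[ a ] inA a ≡ true
    q∉A    : inA q ≡ false

module _ (C : ACA) where
  open ACA C

  State : Set
  State = Fin nQ

  Config : Set
  Config = ℤ → State

  Δ : Config → Config
  Δ c z = δ (c (z - 1ℤ)) (c z) (c (z + 1ℤ))

  Δ^ : ℕ → Config → Config
  Δ^ zero    c = c
  Δ^ (suc τ) c = Δ (Δ^ τ c)

  letterAt : List State → ℕ → State
  letterAt []      _       = q
  letterAt (x ∷ w) zero    = x
  letterAt (x ∷ w) (suc i) = letterAt w i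

  initConfig : List State → Config
  initConfig w (+ i)      = letterAt w i
  initConfig w -[1+ _ ]   = q

  IsInput : List State → Set
  IsInput w = (w ≢ []) × All (λ a → T (inΣ a)) w

  AllAccepting : Config → Set
  AllAccepting c = ∀ z → T (inA (c z)) ⊎ (c z ≡ q)

  AcceptingAt : List State → ℕ → Set
  AcceptingAt w τ = AllAccepting (Δ^ τ (initConfig w))

  _∈L : List State → Set
  w ∈L = IsInput w × ∃[ τ ] AcceptingAt w τ

  AcceptsInSteps : List State → ℕ → Set
  AcceptsInSteps w τ = IsInput w × AcceptingAt w τ × (∀ τ' → AcceptingAt w τ' → τ ≤ τ')

  TimeBoundedBy : (ℕ → ℕ) → Set
  TimeBoundedBy t = ∀ w → w ∈L → ∃[ τ ] (AcceptsInSteps w τ × τ ≤ t (length w))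

prefix : {A : Set} → ℕ → List A → List A
prefix k w = take k w

suffix : {A : Set} → ℕ → List A → List A
suffix k w = drop (length w ∸ k) w

InInfixes : {A : Set} → ℕ → List A → List A → Set
InInfixes k w u =
  (length w ≤ k × u ≡ w) ⊎
  (k < length w × length u ≡ k × ∃[ x ] ∃[ y ] w ≡ x ++ u ++ y)

SameInfixes : {A : Set} → ℕ → List A → List A → Set
SameInfixes {A} k w w' = ∀ (u : List A) → InInfixes k w u ⇔ InInfixes k w' u

-- After τ steps the state of a cell depends only on the 2τ + 1 initial cells centred on it.
-- An accepted w is accepted after some τ ≤ μ steps, and every window of width 2τ + 1 of the
-- q-padded input w' also occurs in that of w: at the left border inside the common prefix of
-- length 2μ, at the right border inside the common suffix, and otherwise inside an infix of
-- length 2μ + 1 of w', which is an infix of w too.  So every cell of Δ^τ applied to the initial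
-- configuration of w' equals some cell of the accepting configuration reached from w.
module Submission where

open import Defs
open import Data.Nat using (ℕ; _*_; _+_; _⊔_)
open import Data.List using (List; length)
open import Relation.Binary.PropositionalEquality using (_≡_)
open import Function using (_⇔_)

open import Algebra.Bundles using (AbelianGroup)
open import Data.Bool using (T)
open import Data.Integer using (ℤ; +_; -[1+_]; 0ℤ; ∣_∣; +≤+; +<+)
  renaming (_+_ to _+ᶻ_; _-_ to _-ᶻ_; _<_ to _<ᶻ_)
import Data.Integer.Properties as ℤ
open import Data.List using ([]; _∷_; take; drop; _++_)
open import Data.List.Properties using (length-take; length-drop; take++drop≡id; ++-identityʳ)
open import Data.Nat using (zero; suc; _≤_; _<_; _∸_; z≤n; s≤s; s≤s⁻¹; _≤?_)
open import Data.Nat.Properties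
open import Data.Product using (∃-syntax; _×_; _,_; proj₁; proj₂)
open import Data.Sum using (_⊎_; inj₁; inj₂)
open import Function.Bundles using (Equivalence; mk⇔)
open import Function.Construct.Symmetry using (⇔-sym)
open import Relation.Binary.PropositionalEquality
  using (refl; sym; trans; cong; subst; module ≡-Reasoning)
open import Relation.Nullary using (yes; no)

open import Algebra.Properties.Group (AbelianGroup.group ℤ.+-0-abelianGroup)
  using (//-rightDividesˡ)

interval-in-block : ∀ {m k n s} → m ≤ k → k ≤ n → s + m ≤ n →
                    ∃[ s₀ ] ∃[ d ] (s₀ + d ≡ s × d + m ≤ k × s₀ + k ≤ n)
interval-in-block {m} {k} {n} {s} m≤k k≤n s+m≤n with s + k ≤? n
... | yes s+k≤n = s , 0 , +-identityʳ s , m≤k , s+k≤n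
... | no  s+k≰n = n ∸ k , s ∸ (n ∸ k) , s₀+d≡s , d+m≤k , ≤-reflexive (m∸n+n≡m k≤n)
  where
  s₀≤s : n ∸ k ≤ s
  s₀≤s = m≤n+o⇒m∸n≤o n k (subst (n ≤_) (+-comm s k) (<⇒≤ (≰⇒> s+k≰n)))
  s₀+d≡s : n ∸ k + (s ∸ (n ∸ k)) ≡ s
  s₀+d≡s = m+[n∸m]≡n s₀≤s
  d+m≤k : s ∸ (n ∸ k) + m ≤ k
  d+m≤k = +-cancelˡ-≤ (n ∸ k) _ _ (begin
    n ∸ k + (s ∸ (n ∸ k) + m) ≡⟨ sym (+-assoc (n ∸ k) _ m) ⟩
    n ∸ k + (s ∸ (n ∸ k)) + m ≡⟨ cong (_+ m) s₀+d≡s ⟩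
    s + m                     ≤⟨ s+m≤n ⟩
    n                         ≡⟨ sym (m+[n∸m]≡n k≤n) ⟩
    k + (n ∸ k)               ≡⟨ +-comm k (n ∸ k) ⟩
    n ∸ k + k                 ∎)
    where open ≤-Reasoning

module _ {A : Set} where

  InInfixes⇒infix : ∀ {k} {w u : List A} → InInfixes k w u → ∃[ x ] ∃[ y ] w ≡ x ++ u ++ y
  InInfixes⇒infix (inj₁ (_ , refl))              = [] , [] , sym (++-identityʳ _)
  InInfixes⇒infix (inj₂ (_ , _ , x , y , w≡xuy)) = x , y , w≡xuy

  split₃ : ∀ s k (w : List A) → s + k ≤ length w →
           ∃[ x ] ∃[ u ] ∃[ y ] (w ≡ x ++ u ++ y × length x ≡ s × length u ≡ k)
  split₃ s k w s+k≤∣w∣ =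
    take s w , take k (drop s w) , drop k (drop s w) , w≡ , ∣x∣≡s , ∣u∣≡k
    where
    w≡ : w ≡ take s w ++ take k (drop s w) ++ drop k (drop s w)
    w≡ = sym (trans (cong (take s w ++_) (take++drop≡id k (drop s w))) (take++drop≡id s w))
    ∣x∣≡s : length (take s w) ≡ s
    ∣x∣≡s = trans (length-take s w) (m≤n⇒m⊓n≡m (≤-trans (m≤m+n s k) s+k≤∣w∣))
    ∣u∣≡k : length (take k (drop s w)) ≡ k
    ∣u∣≡k = trans (length-take k (drop s w))
              (m≤n⇒m⊓n≡m (subst (k ≤_) (sym (length-drop s w))
                (m+n≤o⇒m≤o∸n k (subst (_≤ length w) (+-comm s k) s+k≤∣w∣))))

  block-containing : ∀ {m k s} {w : List A} → m ≤ k → s + m ≤ length w →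
    ∃[ x ] ∃[ u ] ∃[ y ] ∃[ d ]
      (w ≡ x ++ u ++ y × InInfixes k w u × length x + d ≡ s × d + m ≤ length u)
  block-containing {m} {k} {s} {w} m≤k s+m≤∣w∣ with length w ≤? k
  ... | yes ∣w∣≤k = [] , w , [] , s , sym (++-identityʳ w) , inj₁ (∣w∣≤k , refl) , refl , s+m≤∣w∣
  ... | no  ∣w∣≰k with interval-in-block m≤k (<⇒≤ (≰⇒> ∣w∣≰k)) s+m≤∣w∣
  ...   | s₀ , d , s₀+d≡s , d+m≤k , s₀+k≤∣w∣ with split₃ s₀ k w s₀+k≤∣w∣
  ...     | x , u , y , w≡xuy , ∣x∣≡s₀ , ∣u∣≡k =
    x , u , y , d , w≡xuy , inj₂ (≰⇒> ∣w∣≰k , ∣u∣≡k , x , y , w≡xuy) ,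
    trans (cong (_+ d) ∣x∣≡s₀) s₀+d≡s , subst (d + m ≤_) (sym ∣u∣≡k) d+m≤k

module _ (C : ACA) where
  open ACA C
  open ≡-Reasoning

  letterAt-take : ∀ {k} w {i} → i < k → letterAt C (take k w) i ≡ letterAt C w i
  letterAt-take {suc k} []      _                 = refl
  letterAt-take {suc k} (a ∷ w) {zero}  _         = refl
  letterAt-take {suc k} (a ∷ w) {suc i} (s≤s i<k) = letterAt-take w i<k

  letterAt-drop : ∀ j w i → letterAt C (drop j w) i ≡ letterAt C w (j + i)
  letterAt-drop zero    w       i = refl
  letterAt-drop (suc j) []      i = refl
  letterAt-drop (suc j) (a ∷ w) i = letterAt-drop j w i

  letterAt-++ʳ : ∀ x v i → letterAt C (x ++ v) (length x + i) ≡ letterAt C v i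
  letterAt-++ʳ []      v i = refl
  letterAt-++ʳ (a ∷ x) v i = letterAt-++ʳ x v i

  letterAt-++ˡ : ∀ u y {i} → i < length u → letterAt C (u ++ y) i ≡ letterAt C u i
  letterAt-++ˡ (a ∷ u) y {zero}  _         = refl
  letterAt-++ˡ (a ∷ u) y {suc i} (s≤s i<u) = letterAt-++ˡ u y i<u

  letterAt-infix : ∀ {w} x u y {i} → w ≡ x ++ u ++ y → i < length u →
                   letterAt C w (length x + i) ≡ letterAt C u i
  letterAt-infix x u y refl i<∣u∣ = trans (letterAt-++ʳ x (u ++ y) _) (letterAt-++ˡ u y i<∣u∣)

  Agree : ℕ → Config C → ℤ → Config C → ℤ → Set
  Agree m c b c' b' = ∀ i → i < m → c (b +ᶻ + i) ≡ c' (b' +ᶻ + i)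

  δ-cong : ∀ {x x' y y' z z'} → x ≡ x' → y ≡ y' → z ≡ z' → δ x y z ≡ δ x' y' z'
  δ-cong refl refl refl = refl

  Δ^-local : ∀ τ {c c' : Config C} {x x'} →
             (∀ d → ∣ d ∣ ≤ τ → c (x +ᶻ d) ≡ c' (x' +ᶻ d)) → Δ^ C τ c x ≡ Δ^ C τ c' x'
  Δ^-local zero {c} {c'} {x} {x'} agree = begin
    c x            ≡⟨ cong c (sym (ℤ.+-identityʳ x)) ⟩
    c (x +ᶻ 0ℤ)    ≡⟨ agree 0ℤ z≤n ⟩
    c' (x' +ᶻ 0ℤ)  ≡⟨ cong c' (ℤ.+-identityʳ x') ⟩
    c' x'          ∎
  Δ^-local (suc τ) {c} {c'} {x} {x'} agree =
    δ-cong (shifted -[1+ 0 ] ≤-refl)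
           (Δ^-local τ (λ d ∣d∣≤τ → agree d (m≤n⇒m≤1+n ∣d∣≤τ)))
           (shifted (+ 1) ≤-refl)
    where
    shifted : ∀ e → ∣ e ∣ ≤ 1 → Δ^ C τ c (x +ᶻ e) ≡ Δ^ C τ c' (x' +ᶻ e)
    shifted e ∣e∣≤1 = Δ^-local τ λ d ∣d∣≤τ → begin
      c (x +ᶻ e +ᶻ d)      ≡⟨ cong c (ℤ.+-assoc x e d) ⟩
      c (x +ᶻ (e +ᶻ d))    ≡⟨ agree (e +ᶻ d) (≤-trans (ℤ.∣i+j∣≤∣i∣+∣j∣ e d) (+-mono-≤ ∣e∣≤1 ∣d∣≤τ)) ⟩
      c' (x' +ᶻ (e +ᶻ d))  ≡⟨ cong c' (sym (ℤ.+-assoc x' e d)) ⟩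
      c' (x' +ᶻ e +ᶻ d)    ∎

  centre-offset : ∀ {τ} d → ∣ d ∣ ≤ τ → ∃[ i ] (i < suc (2 * τ) × + τ +ᶻ d ≡ + i)
  centre-offset {τ} (+ n)    n≤τ   =
    τ + n , s≤s (+-monoʳ-≤ τ (≤-trans n≤τ (m≤m+n τ 0))) , refl
  centre-offset {τ} -[1+ n ] 1+n≤τ =
    τ ∸ suc n , s≤s (≤-trans (m∸n≤m τ (suc n)) (m≤m+n τ (τ + 0))) , ℤ.⊖-≥ 1+n≤τ

  Δ^-agree : ∀ τ {c c'} b b' → Agree (suc (2 * τ)) c b c' b' →
             Δ^ C τ c (b +ᶻ + τ) ≡ Δ^ C τ c' (b' +ᶻ + τ)
  Δ^-agree τ {c} {c'} b b' agree = Δ^-local τ centred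
    where
    centred : ∀ d → ∣ d ∣ ≤ τ → c (b +ᶻ + τ +ᶻ d) ≡ c' (b' +ᶻ + τ +ᶻ d)
    centred d ∣d∣≤τ with centre-offset d ∣d∣≤τ
    ... | i , i<m , τ+d≡i = begin
      c (b +ᶻ + τ +ᶻ d)    ≡⟨ cong c (trans (ℤ.+-assoc b (+ τ) d) (cong (b +ᶻ_) τ+d≡i)) ⟩
      c (b +ᶻ + i)         ≡⟨ agree i i<m ⟩
      c' (b' +ᶻ + i)       ≡⟨ cong c' (trans (cong (b' +ᶻ_) (sym τ+d≡i)) (sym (ℤ.+-assoc b' (+ τ) d))) ⟩
      c' (b' +ᶻ + τ +ᶻ d)  ∎

  initConfig-prefix : ∀ {K} w w' → prefix K w ≡ prefix K w' →
                      ∀ {x} → x <ᶻ + K → initConfig C w x ≡ initConfig C w' x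
  initConfig-prefix w w' pre { -[1+ _ ] } _ = refl
  initConfig-prefix {K} w w' pre {+ j} (+<+ j<K) = begin
    letterAt C w j           ≡⟨ sym (letterAt-take w j<K) ⟩
    letterAt C (take K w) j  ≡⟨ cong (λ v → letterAt C v j) pre ⟩
    letterAt C (take K w') j ≡⟨ letterAt-take w' j<K ⟩
    letterAt C w' j          ∎

  window-prefix : ∀ {K m} w w' → prefix K w ≡ prefix K w' → m ≤ suc K →
                  ∀ n → Agree m (initConfig C w) -[1+ n ] (initConfig C w') -[1+ n ]
  window-prefix w w' pre m≤1+K n i i<m =
    initConfig-prefix w w' pre (ℤ.<-≤-trans (ℤ.m⊖1+n<m i (suc n)) (+≤+ (s≤s⁻¹ (<-≤-trans i<m m≤1+K))))

  window-suffix : ∀ a a' w w' → drop a w ≡ drop a' w' → ∀ {m s} → a' ≤ s →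
                  ∃[ b ] Agree m (initConfig C w) b (initConfig C w') (+ s)
  window-suffix a a' w w' suf {s = s} a'≤s = + (a + (s ∸ a')) , λ i _ → begin
    letterAt C w (a + (s ∸ a') + i)     ≡⟨ cong (letterAt C w) (+-assoc a (s ∸ a') i) ⟩
    letterAt C w (a + (s ∸ a' + i))     ≡⟨ sym (letterAt-drop a w (s ∸ a' + i)) ⟩
    letterAt C (drop a w) (s ∸ a' + i)  ≡⟨ cong (λ v → letterAt C v (s ∸ a' + i)) suf ⟩
    letterAt C (drop a' w') (s ∸ a' + i) ≡⟨ letterAt-drop a' w' (s ∸ a' + i) ⟩
    letterAt C w' (a' + (s ∸ a' + i))   ≡⟨ cong (letterAt C w') (sym (+-assoc a' (s ∸ a') i)) ⟩
    letterAt C w' (a' + (s ∸ a') + i)   ≡⟨ cong (λ p → letterAt C w' (p + i)) (m+[n∸m]≡n a'≤s) ⟩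
    letterAt C w' (s + i)               ∎

  window-common-infix : ∀ {w w' m} x u y x' y' d → w ≡ x ++ u ++ y → w' ≡ x' ++ u ++ y' →
                        d + m ≤ length u →
                        Agree m (initConfig C w) (+ (length x + d)) (initConfig C w') (+ (length x' + d))
  window-common-infix {w} {w'} x u y x' y' d w≡xuy w'≡x'uy' d+m≤∣u∣ i i<m = begin
    letterAt C w (length x + d + i)    ≡⟨ cong (letterAt C w) (+-assoc (length x) d i) ⟩
    letterAt C w (length x + (d + i))  ≡⟨ letterAt-infix x u y w≡xuy d+i<∣u∣ ⟩
    letterAt C u (d + i)               ≡⟨ sym (letterAt-infix x' u y' w'≡x'uy' d+i<∣u∣) ⟩
    letterAt C w' (length x' + (d + i)) ≡⟨ cong (letterAt C w') (sym (+-assoc (length x') d i)) ⟩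
    letterAt C w' (length x' + d + i)  ∎
    where
    d+i<∣u∣ : d + i < length u
    d+i<∣u∣ = <-≤-trans (+-monoʳ-< d i<m) d+m≤∣u∣

  window-infix : ∀ {k m s w w'} → SameInfixes k w w' → m ≤ k → s + m ≤ length w' →
                 ∃[ b ] Agree m (initConfig C w) b (initConfig C w') (+ s)
  window-infix {m = m} {w = w} {w'} same m≤k s+m≤∣w'∣ with block-containing m≤k s+m≤∣w'∣
  ... | x' , u , y' , d , w'≡x'uy' , u∈Iw' , ∣x'∣+d≡s , d+m≤∣u∣
    with InInfixes⇒infix (Equivalence.from (same u) u∈Iw')
  ...   | x , y , w≡xuy =
    + (length x + d) ,
    subst (λ s → Agree m (initConfig C w) (+ (length x + d)) (initConfig C w') (+ s)) ∣x'∣+d≡s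
          (window-common-infix x u y x' y' d w≡xuy w'≡x'uy' d+m≤∣u∣)

  matching-window : ∀ {K m} w w' →
                    prefix K w ≡ prefix K w' → SameInfixes (K + 1) w w' → suffix K w ≡ suffix K w' →
                    m ≤ K + 1 → ∀ b' → ∃[ b ] Agree m (initConfig C w) b (initConfig C w') b'
  matching-window {K} {m} w w' pre same suf m≤ -[1+ n ] =
    -[1+ n ] , window-prefix w w' pre (subst (m ≤_) (+-comm K 1) m≤) n
  matching-window {K} {m} w w' pre same suf m≤ (+ s) with length w' ∸ K ≤? s
  ... | yes a'≤s = window-suffix (length w ∸ K) (length w' ∸ K) w w' suf a'≤s
  ... | no  a'≰s = window-infix same m≤ s+m≤∣w'∣
    where
    s<a' : s < length w' ∸ K
    s<a' = ≰⇒> a'≰s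
    s+m≤∣w'∣ : s + m ≤ length w'
    s+m≤∣w'∣ = ≤-trans (+-monoʳ-≤ s m≤)
      (subst (_≤ length w') (sym (trans (cong (λ n → s + n) (+-comm K 1)) (+-suc s K)))
        (m≤o∸n⇒m+n≤o (suc s) (<⇒≤ (m∸n≢0⇒n<m (m<n⇒n≢0 s<a'))) s<a'))

  accepting-transfer : ∀ {μ τ} w w' → τ ≤ μ →
    prefix (2 * μ) w ≡ prefix (2 * μ) w' → SameInfixes (2 * μ + 1) w w' →
    suffix (2 * μ) w ≡ suffix (2 * μ) w' → AcceptingAt C w τ → AcceptingAt C w' τ
  accepting-transfer {μ} {τ} w w' τ≤μ pre same suf accepting z' =
    subst (λ a → T (inA a) ⊎ a ≡ q) same-cell (accepting (b +ᶻ + τ))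
    where
    width≤ : suc (2 * τ) ≤ 2 * μ + 1
    width≤ = subst (suc (2 * τ) ≤_) (+-comm 1 (2 * μ)) (s≤s (*-monoʳ-≤ 2 τ≤μ))
    window : ∃[ b ] Agree (suc (2 * τ)) (initConfig C w) b (initConfig C w') (z' -ᶻ + τ)
    window = matching-window w w' pre same suf width≤ (z' -ᶻ + τ)
    b = proj₁ window
    same-cell : Δ^ C τ (initConfig C w) (b +ᶻ + τ) ≡ Δ^ C τ (initConfig C w') z'
    same-cell = trans (Δ^-agree τ b (z' -ᶻ + τ) (proj₂ window))
                      (cong (Δ^ C τ (initConfig C w')) (//-rightDividesˡ (+ τ) z'))

  ∈L-transfer : ∀ t → TimeBoundedBy C t → ∀ {μ} w w' → t (length w) ≤ μ → IsInput C w' →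
    prefix (2 * μ) w ≡ prefix (2 * μ) w' → SameInfixes (2 * μ + 1) w w' →
    suffix (2 * μ) w ≡ suffix (2 * μ) w' → _∈L C w → _∈L C w'
  ∈L-transfer t bounded w w' t∣w∣≤μ w'-input pre same suf w∈L with bounded _ w∈L
  ... | τ , (_ , accepting , _) , τ≤t∣w∣ =
    w'-input , τ , accepting-transfer w w' (≤-trans τ≤t∣w∣ t∣w∣≤μ) pre same suf accepting

lemma2 : (C : ACA) (t : ℕ → ℕ) → TimeBoundedBy C t →
         (w w' : List (State C)) → IsInput C w → IsInput C w' →
         let μ = t (length w) ⊔ t (length w') in
         prefix (2 * μ) w ≡ prefix (2 * μ) w' →
         SameInfixes (2 * μ + 1) w w' →
         suffix (2 * μ) w ≡ suffix (2 * μ) w' →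
         (_∈L C w ⇔ _∈L C w')
lemma2 C t bounded w w' w-input w'-input pre same suf = mk⇔
  (∈L-transfer C t bounded w w' (m≤m⊔n (t (length w)) (t (length w'))) w'-input pre same suf)
  (∈L-transfer C t bounded w' w (m≤n⊔m (t (length w)) (t (length w'))) w-input
     (sym pre) (λ u → ⇔-sym (same u)) (sym suf))
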